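{- For every integer $\alpha\ge 1$, $A_0(\alpha)=|\Sigma_1|\cdot A(\alpha-1)$.
   Context: Let $\Sigma$ be a finite totally ordered alphabet with $|\Sigma|=2^b$; each letter is identified bijectively with a $b$-bit vector and $a\oplus a'$ is the letter whose bit vector is the componentwise XOR. For equal-length words, $\oplus$ acts letterwise; equal-length words are compared lexicographically. An $m$-mer of a word is a contiguous factor of length $m$. Fix integers $1\le m<k$, a word $w=a_1\cdots a_m\in\Sigma^m$ and a key $\gamma=c_1\cdots c_m\in\Sigma^m$. $\Sigma_1=\{a\in\Sigma: a\oplus c_1>a_1\oplus c_1\}$. A word $y$ is an antemer if every $m$-mer $w'$ of the word $yw$ other than the last one (the suffix $w$) satisfies $w'\oplus\gamma>w\oplus\gamma$. $A(\alpha)$ is the number of antemers of length $\alpha$ (with $A(0)=1$), and $A_i(\alpha)$ the number of antemers of length $\alpha$ whose longest common prefix with $w$ has length exactly $i$. -}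

module Defs where

open import Data.Nat using (ℕ; zero; suc; _^_)
open import Data.Bool using (Bool; _xor_; if_then_else_)
open import Data.Fin using (Fin; _<_; _≟_)
open import Data.Fin.Properties using (<-cmp)
open import Data.Vec using (Vec; zipWith; toList; head)
open import Data.List using (List; []; _∷_; [_]; map; concatMap; take; drop; length; filter; upTo; allFin; _++_)
open import Data.List.Relation.Unary.All using (All; all?)
open import Data.List.Relation.Binary.Lex.Strict using (Lex-<; <-decidable)
open import Data.Product using (_×_)
open import Function.Bundles using (_↔_; Inverse)
open import Relation.Binary.PropositionalEquality using (_≡_)
open import Relation.Nullary using (Dec; does)
open import Relation.Nullary.Decidable using (_×-dec_)
import Data.Nat as ℕ

-- Alphabet Σ of size 2^b: WLOG Fin (2 ^ b) with its natural total order
-- (any finite totally ordered set of that size is order-isomorphic to it).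
-- φ is the (arbitrary) bijection identifying letters with b-bit vectors.
module Setup (b : ℕ) (φ : Fin (2 ^ b) ↔ Vec Bool b) where

  Σ : Set
  Σ = Fin (2 ^ b)

  open Inverse φ using (to; from)

  _⊕_ : Σ → Σ → Σ
  a ⊕ a' = from (zipWith _xor_ (to a) (to a'))

  _⊕w_ : List Σ → List Σ → List Σ
  [] ⊕w _ = []
  (_ ∷ _) ⊕w [] = []
  (a ∷ x) ⊕w (a' ∷ y) = (a ⊕ a') ∷ (x ⊕w y)

  _<lex_ : List Σ → List Σ → Set
  _<lex_ = Lex-< _≡_ _<_

  _<lex?_ : (u v : List Σ) → Dec (u <lex v)
  _<lex?_ = <-decidable _≟_ Data.Fin._<?_

  allWords : ℕ → List (List Σ)
  allWords zero = [ [] ]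
  allWords (suc n) = concatMap (λ a → map (a ∷_) (allWords n)) (allFin (2 ^ b))

  lcp : List Σ → List Σ → ℕ
  lcp (a ∷ x) (a' ∷ y) = if does (a ≟ a') then suc (lcp x y) else zero
  lcp _ _ = zero

  -- the remaining data: m ≥ 1 is written suc m, w = a₁…a_{m}, γ = c₁…c_{m}
  module Words (m : ℕ) (w γ : Vec Σ (suc m)) where

    wL γL : List Σ
    wL = toList w
    γL = toList γ

    -- y is an antemer: every m-mer of y w starting at position i < |y|
    -- (i.e. every m-mer other than the last one) w' satisfies w' ⊕ γ > w ⊕ γ
    Good : List Σ → ℕ → Set
    Good y i = (wL ⊕w γL) <lex (take (suc m) (drop i (y ++ wL)) ⊕w γL)

    IsAntemer : List Σ → Set
    IsAntemer y = All (Good y) (upTo (length y))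

    isAntemer? : (y : List Σ) → Dec (IsAntemer y)
    isAntemer? y = all? (λ i → (wL ⊕w γL) <lex? (take (suc m) (drop i (y ++ wL)) ⊕w γL)) (upTo (length y))

    A : ℕ → ℕ
    A α = length (filter isAntemer? (allWords α))

    Aᵢ : ℕ → ℕ → ℕ
    Aᵢ i α = length (filter (λ y → isAntemer? y ×-dec (lcp y wL ℕ.≟ i)) (allWords α))

    card-Σ₁ : ℕ
    card-Σ₁ = length (filter (λ a → (head w ⊕ head γ) Data.Fin.<? (a ⊕ head γ)) (allFin (2 ^ b)))

-- A word y of length α + 1 with lcp(y, w) = 0 has the form a y′ with a ≠ a₁. Every
-- m-mer of y w but the first is an m-mer of y′ w other than its suffix w, so y is an
-- antemer only if y′ is one; and since a ⊕ c₁ ≠ a₁ ⊕ c₁, the first m-mer beats w ⊕ γ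
-- exactly when a ⊕ c₁ > a₁ ⊕ c₁, i.e. a ∈ Σ₁. Hence the antemers counted by A₀(α + 1)
-- correspond to the pairs in Σ₁ × {antemers of length α}.
module Submission where

open import Defs
open import Data.Nat using (ℕ; suc; _^_; _*_; _+_; _<_; _≥_; _≟_)
open import Data.Bool using (Bool; false; _xor_)
open import Data.Bool.Properties using (xor-assoc; xor-same; xor-identityʳ)
open import Data.Fin as Fin using (Fin)
open import Data.Fin.Properties using (<-irrefl)
open import Data.Vec using (Vec; []; _∷_; zipWith)
open import Data.List using (List; []; _∷_; length; filter; map; concatMap; allFin)
open import Data.List.Properties using (filter-++; length-++)
open import Data.List.Relation.Unary.All using ([]; _∷_)
open import Data.List.Relation.Unary.All.Properties using (applyUpTo⁺₁; applyUpTo⁻)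
open import Data.List.Relation.Binary.Lex.Core using (this; next)
open import Data.Product using (_×_; _,_; proj₁; proj₂)
open import Function using (id; _⇔_; mk⇔; Injection; Equivalence)
open import Function.Bundles using (_↔_; Inverse)
open import Function.Properties.Inverse using (Inverse⇒Injection; ↔-sym)
open import Level using (Level)
open import Relation.Binary.PropositionalEquality using (_≡_; _≢_; refl; sym; cong; cong₂; module ≡-Reasoning)
open import Relation.Nullary using (yes; no; ¬_; contradiction)
open import Relation.Nullary.Decidable using (_×-dec_)
open import Relation.Unary using (Pred; Decidable)

private
  variable
    ℓ ℓ′ ℓ″ : Level
    A : Set

module _ {S : Pred A ℓ} {T : Pred (List A) ℓ′} {P : Pred (List A) ℓ″}
         (P? : Decidable P) (S? : Decidable S) (T? : Decidable T)
         (P-∷ : ∀ a y → P (a ∷ y) ⇔ (S a × T y)) where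

  length-filter-map-∷-accept : ∀ {a} → S a → (ys : List (List A)) →
    length (filter P? (map (a ∷_) ys)) ≡ length (filter T? ys)
  length-filter-map-∷-accept s [] = refl
  length-filter-map-∷-accept {a} s (y ∷ ys) with P? (a ∷ y) | T? y
  ... | yes _  | yes _ = cong suc (length-filter-map-∷-accept s ys)
  ... | no _   | no _  = length-filter-map-∷-accept s ys
  ... | yes p  | no ¬t = contradiction (proj₂ (Equivalence.to (P-∷ a y) p)) ¬t
  ... | no ¬p  | yes t = contradiction (Equivalence.from (P-∷ a y) (s , t)) ¬p

  length-filter-map-∷-reject : ∀ {a} → ¬ S a → (ys : List (List A)) →
    length (filter P? (map (a ∷_) ys)) ≡ 0
  length-filter-map-∷-reject ¬s [] = refl
  length-filter-map-∷-reject {a} ¬s (y ∷ ys) with P? (a ∷ y)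
  ... | yes p = contradiction (proj₁ (Equivalence.to (P-∷ a y) p)) ¬s
  ... | no _  = length-filter-map-∷-reject ¬s ys

  length-filter-prefixed : (xs : List A) (ys : List (List A)) →
    length (filter P? (concatMap (λ a → map (a ∷_) ys) xs)) ≡
    length (filter S? xs) * length (filter T? ys)
  length-filter-prefixed [] ys = refl
  length-filter-prefixed (a ∷ xs) ys
    rewrite filter-++ P? (map (a ∷_) ys) (concatMap (λ a → map (a ∷_) ys) xs)
          | length-++ (filter P? (map (a ∷_) ys)) {filter P? (concatMap (λ a → map (a ∷_) ys) xs)}
    with S? a
  ... | yes s = cong₂ _+_ (length-filter-map-∷-accept s ys) (length-filter-prefixed xs ys)
  ... | no ¬s = cong₂ _+_ (length-filter-map-∷-reject ¬s ys) (length-filter-prefixed xs ys)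

xor-involutiveʳ : ∀ c x → (x xor c) xor c ≡ x
xor-involutiveʳ c x = begin
  (x xor c) xor c ≡⟨ xor-assoc x c c ⟩
  x xor (c xor c) ≡⟨ cong (x xor_) (xor-same c) ⟩
  x xor false     ≡⟨ xor-identityʳ x ⟩
  x               ∎
  where open ≡-Reasoning

zipWith-xor-involutiveʳ : ∀ {n} (c x : Vec Bool n) → zipWith _xor_ (zipWith _xor_ x c) c ≡ x
zipWith-xor-involutiveʳ []       []       = refl
zipWith-xor-involutiveʳ (c ∷ cs) (x ∷ xs) = cong₂ _∷_ (xor-involutiveʳ c x) (zipWith-xor-involutiveʳ cs xs)

module _ (b : ℕ) (φ : Fin (2 ^ b) ↔ Vec Bool b) where
  open Setup b φ
  open Inverse φ using (to; from)

  ⊕-cancelʳ : ∀ c {a a′} → a ⊕ c ≡ a′ ⊕ c → a ≡ a′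
  ⊕-cancelʳ c {a} {a′} eq = to-injective (begin
    to a                                                ≡⟨ zipWith-xor-involutiveʳ (to c) (to a) ⟨
    zipWith _xor_ (zipWith _xor_ (to a) (to c)) (to c)  ≡⟨ cong (λ v → zipWith _xor_ v (to c)) (from-injective eq) ⟩
    zipWith _xor_ (zipWith _xor_ (to a′) (to c)) (to c) ≡⟨ zipWith-xor-involutiveʳ (to c) (to a′) ⟩
    to a′                                               ∎)
    where
    open ≡-Reasoning
    to-injective : ∀ {x y} → to x ≡ to y → x ≡ y
    to-injective = Injection.injective (Inverse⇒Injection φ)
    from-injective : ∀ {u v} → from u ≡ from v → u ≡ v
    from-injective = Injection.injective (Inverse⇒Injection (↔-sym φ))

  module _ (m : ℕ) (a₁ c₁ : Σ) (w′ γ′ : Vec Σ m) where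
    open Words m (a₁ ∷ w′) (c₁ ∷ γ′)

    Σ₁ : Pred Σ _
    Σ₁ a = a₁ ⊕ c₁ Fin.< a ⊕ c₁

    Σ₁? : Decidable Σ₁
    Σ₁? a = a₁ ⊕ c₁ Fin.<? a ⊕ c₁

    -- Good (a ∷ y) (suc i) and Good y i are the same type, since drop (suc i) ((a ∷ y) ++ wL)
    -- reduces to drop i (y ++ wL).
    isAntemer-∷⁻ : ∀ {a y} → IsAntemer (a ∷ y) → Good (a ∷ y) 0 × IsAntemer y
    isAntemer-∷⁻ {y = y} (g₀ ∷ gs) = g₀ , applyUpTo⁺₁ id (length y) (applyUpTo⁻ suc (length y) gs)

    isAntemer-∷⁺ : ∀ {a y} → Good (a ∷ y) 0 → IsAntemer y → IsAntemer (a ∷ y)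
    isAntemer-∷⁺ {y = y} g₀ gs = g₀ ∷ applyUpTo⁺₁ suc (length y) (applyUpTo⁻ id (length y) gs)

    lcp-∷≡0⇔ : ∀ a y → lcp (a ∷ y) wL ≡ 0 ⇔ a ≢ a₁
    lcp-∷≡0⇔ a y with a Fin.≟ a₁
    ... | yes a≡a₁ = mk⇔ (λ ()) (λ a≢a₁ → contradiction a≡a₁ a≢a₁)
    ... | no  a≢a₁ = mk⇔ (λ _ → a≢a₁) (λ _ → refl)

    Σ₁⇒≢a₁ : ∀ {a} → Σ₁ a → a ≢ a₁
    Σ₁⇒≢a₁ s a≡a₁ = <-irrefl (cong (_⊕ c₁) (sym a≡a₁)) s

    good-head⇔Σ₁ : ∀ {a y} → a ≢ a₁ → Good (a ∷ y) 0 ⇔ Σ₁ a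
    good-head⇔Σ₁ a≢a₁ = mk⇔ (λ { (this lt) → lt ; (next eq _) → contradiction (sym (⊕-cancelʳ c₁ eq)) a≢a₁ }) this

    antemer-lcp≡0-∷⇔ : ∀ a y → (IsAntemer (a ∷ y) × lcp (a ∷ y) wL ≡ 0) ⇔ (Σ₁ a × IsAntemer y)
    antemer-lcp≡0-∷⇔ a y = mk⇔ decompose compose
      where
      decompose : IsAntemer (a ∷ y) × lcp (a ∷ y) wL ≡ 0 → Σ₁ a × IsAntemer y
      decompose (ant , l) with isAntemer-∷⁻ ant
      ... | g₀ , gs = Equivalence.to (good-head⇔Σ₁ (Equivalence.to (lcp-∷≡0⇔ a y) l)) g₀ , gs
      compose : Σ₁ a × IsAntemer y → IsAntemer (a ∷ y) × lcp (a ∷ y) wL ≡ 0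
      compose (s , gs) = isAntemer-∷⁺ (this s) gs , Equivalence.from (lcp-∷≡0⇔ a y) (Σ₁⇒≢a₁ s)

lemma2 : (b : ℕ) (φ : Fin (2 ^ b) ↔ Vec Bool b) (m k : ℕ) → suc m < k →
         (w γ : Vec (Fin (2 ^ b)) (suc m)) → (α : ℕ) → α ≥ 1 →
         Setup.Words.Aᵢ b φ m w γ 0 α ≡ Setup.Words.card-Σ₁ b φ m w γ * Setup.Words.A b φ m w γ (α Data.Nat.∸ 1)
lemma2 b φ m _ _ (a₁ ∷ w′) (c₁ ∷ γ′) (suc α) _ =
  length-filter-prefixed (λ y → isAntemer? y ×-dec (lcp y wL ≟ 0)) (Σ₁? b φ m a₁ c₁ w′ γ′) isAntemer?
    (antemer-lcp≡0-∷⇔ b φ m a₁ c₁ w′ γ′) (allFin (2 ^ b)) (allWords α)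
  where
  open Setup b φ
  open Words m (a₁ ∷ w′) (c₁ ∷ γ′)
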